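{- Let $N$ be a positive integer and $d\ge 2$. An integer vector $[c_0,\dots,c_d]$ is a geometric progression modulo $N$ such that (1) $c_0,\dots,c_d$ are nonzero, (2) $\gcd(c_0,N)=1$, (3) $[c_0,\dots,c_{d-1}]$ is a rational geometric progression, and (4) $[c_0,\dots,c_{d-1},c_d]$ is not a rational geometric progression, if and only if there exist nonzero integers $a,p,m,k$ such that $\gcd(m,p)=1$, $\gcd(ap,N)=1$, $(am^d-kN)/p$ is a nonzero integer, and $$[c_0,\dots,c_d]=\left[ap^{d-1},ap^{d-2}m,\dots,am^{d-1},\frac{am^d-kN}{p}\right].$$
   Context: An integer vector $[c_0,\dots,c_{\ell-1}]$ is a geometric progression modulo $N$ if there is $r\in\mathbb{Z}/N\mathbb{Z}$ with $c_i\equiv c_0 r^i\pmod N$ for all $0\le i<\ell$. It is a rational geometric progression if there is $\rho\in\mathbb{Q}$ with $c_i=c_0\rho^i$ for all $0\le i<\ell$. -}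

module Defs where

open import Data.Nat.Base as ℕ using (ℕ; zero; suc)
open import Data.Integer.Base as ℤ using (ℤ; +_)
open import Data.Integer.Divisibility using (_∣_)
open import Data.Rational.Base as ℚ using (ℚ; 1ℚ)
open import Data.Fin.Base as Fin using (Fin; toℕ)
open import Data.Unit using (⊤)
open import Data.Product using (∃)
open import Relation.Binary.PropositionalEquality using (_≡_)

toℚ : ℤ → ℚ
toℚ z = z ℚ./ 1

_^ℚ_ : ℚ → ℕ → ℚ
q ^ℚ zero  = 1ℚ
q ^ℚ suc n = q ℚ.* (q ^ℚ n)

_≡_[modℕ_] : ℤ → ℤ → ℕ → Set
a ≡ b [modℕ N ] = (+ N) ∣ (a ℤ.- b)

-- An integer vector c = [c_0,...,c_{ℓ-1}] (c_0 = c zero) is a geometric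
-- progression modulo N: there is r ∈ ℤ/Nℤ (represented by an integer) with
-- c_i ≡ c_0 r^i (mod N) for all 0 ≤ i < ℓ.  (The empty vector vacuously is.)
GeomProgMod : (N : ℕ) {ℓ : ℕ} → (Fin ℓ → ℤ) → Set
GeomProgMod N {zero}  c = ⊤
GeomProgMod N {suc ℓ} c =
  ∃ λ (r : ℤ) → ∀ (i : Fin (suc ℓ)) → c i ≡ (c Fin.zero ℤ.* (r ℤ.^ toℕ i)) [modℕ N ]

RatGeomProg : {ℓ : ℕ} → (Fin ℓ → ℤ) → Set
RatGeomProg {zero}  c = ⊤
RatGeomProg {suc ℓ} c =
  ∃ λ (ρ : ℚ) → ∀ (i : Fin (suc ℓ)) → toℚ (c i) ≡ toℚ (c Fin.zero) ℚ.* (ρ ^ℚ toℕ i)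

{-# OPTIONS --safe #-}
-- The first d entries form a rational progression; write its ratio in lowest terms
-- as m/p. Since c_{d-1} pᵈ⁻¹ = c₀ mᵈ⁻¹ with m, p coprime, pᵈ⁻¹ divides c₀, and the
-- entries are a pᵈ⁻¹, a pᵈ⁻² m, …, a mᵈ⁻¹. For a vector of this shape with a p
-- coprime to N, it is a progression modulo N (ratio m p⁻¹) iff p c_d ≡ a mᵈ (mod N),
-- and a rational progression iff p c_d = a mᵈ. Hence p c_d = a mᵈ - k N, and k ≠ 0
-- exactly when the whole vector is not a rational progression.
module Submission where

open import Defs
open import Data.Nat.Base as ℕ using (ℕ; suc; _≤_; _∸_)
open import Data.Integer.Base as ℤ using (ℤ; +_; _*_; _-_; _^_)
open import Data.Integer.GCD using (gcd)
open import Data.Fin.Base using (Fin; zero; toℕ; fromℕ; inject₁)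
open import Data.Product using (Σ; ∃; _×_; _,_)
open import Data.Product using (proj₁; proj₂)
open import Relation.Binary.PropositionalEquality using (_≡_; _≢_)
open import Function.Bundles using (_⇔_)
open import Relation.Nullary using (¬_)

open import Data.Nat.Base using (zero)
open import Data.Integer.Base using (0ℤ; 1ℤ; -_; _+_; +[1+_]; -[1+_])
import Data.Nat.Properties as ℕ
import Data.Nat.Divisibility as ℕ
import Data.Nat.Coprimality as ℕ
open import Data.Nat.GCD using (module Bézout)
import Data.Integer.Properties as ℤ
open import Data.Integer.Coprimality using (Coprime; coprime-divisor)
import Data.Integer.Coprimality as Coprime
open import Data.Integer.Divisibility.Signed as Signed using (_∣_; divides; ∣ᵤ⇒∣; ∣⇒∣ᵤ)
open import Data.Integer.Tactic.RingSolver using (solve-∀)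
import Data.Rational.Base as ℚ
import Data.Rational.Properties as ℚ
open import Data.Rational.Unnormalised.Base as ℚᵘ using (mkℚᵘ; *≡*)
import Data.Rational.Unnormalised.Properties as ℚᵘ
open import Algebra.Bundles using (Ring)
open import Algebra.Properties.Semiring.Exp (Ring.semiring ℚᵘ.+-*-ring)
  using () renaming (_^_ to _^ᵘ_)
open import Data.Sum using (inj₁; inj₂)
open import Data.Empty using (⊥-elim)
open import Function.Base using (_∘_; case_of_)
open import Function.Bundles using (mk⇔; Equivalence)
open Equivalence using (to; from)
open import Relation.Binary.Bundles using (Setoid)
import Data.Fin.Base as Fin
import Data.Fin.Properties as Fin
open import Relation.Binary.PropositionalEquality
  using (refl; sym; trans; cong; cong₂; subst; subst₂; module ≡-Reasoning)
import Relation.Binary.Reasoning.Setoid as SetoidReasoning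

^-distribʳ-* : ∀ i j n → (i * j) ^ n ≡ i ^ n * j ^ n
^-distribʳ-* i j zero    = refl
^-distribʳ-* i j (suc n) = trans (cong ((i * j) *_) (^-distribʳ-* i j n))
                                 (interchange i j (i ^ n) (j ^ n))
  where
  interchange : ∀ a b c d → (a * b) * (c * d) ≡ (a * c) * (b * d)
  interchange = solve-∀

^∸-*-^ : ∀ i {m n} → n ≤ m → i ^ (m ∸ n) * i ^ n ≡ i ^ m
^∸-*-^ i {m} {n} n≤m = trans (sym (ℤ.^-distribˡ-+-* i (m ∸ n) n))
                             (cong (i ^_) (ℕ.m∸n+n≡m n≤m))

*-≢0 : ∀ {i j} → i ≢ 0ℤ → j ≢ 0ℤ → i * j ≢ 0ℤ
*-≢0 {i} i≢0 j≢0 ij≡0 with ℤ.i*j≡0⇒i≡0∨j≡0 i ij≡0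
... | inj₁ i≡0 = i≢0 i≡0
... | inj₂ j≡0 = j≢0 j≡0

*≢0⇒≢0ˡ : ∀ {i} j → i * j ≢ 0ℤ → i ≢ 0ℤ
*≢0⇒≢0ˡ j ij≢0 refl = ij≢0 (ℤ.*-zeroˡ j)

*≢0⇒≢0ʳ : ∀ i {j} → i * j ≢ 0ℤ → j ≢ 0ℤ
*≢0⇒≢0ʳ i ij≢0 refl = ij≢0 (ℤ.*-zeroʳ i)

^-≢0 : ∀ {i} n → i ≢ 0ℤ → i ^ n ≢ 0ℤ
^-≢0 {i} n i≢0 = i≢0 ∘ ℤ.i^n≡0⇒i≡0 i n

*-cancelˡ-≢0 : ∀ {i} j k → i ≢ 0ℤ → i * j ≡ i * k → j ≡ k
*-cancelˡ-≢0 {i} j k i≢0 = ℤ.*-cancelˡ-≡ i j k {{ℤ.≢-nonZero i≢0}}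

*-cancelʳ-≢0 : ∀ i j {k} → k ≢ 0ℤ → i * k ≡ j * k → i ≡ j
*-cancelʳ-≢0 i j {k} k≢0 = ℤ.*-cancelʳ-≡ i j k {{ℤ.≢-nonZero k≢0}}

coprime⇔gcd≡1 : ∀ {i j} → Coprime i j ⇔ gcd i j ≡ 1ℤ
coprime⇔gcd≡1 = mk⇔ (cong +_ ∘ ℕ.coprime⇒gcd≡1) (ℕ.gcd≡1⇒coprime ∘ cong ℤ.∣_∣)

coprime-∣ˡ : ∀ {m n o} → m ℕ.∣ n → ℕ.Coprime n o → ℕ.Coprime m o
coprime-∣ˡ m∣n n⊥o (d∣m , d∣o) = n⊥o (ℕ.∣-trans d∣m m∣n , d∣o)

coprime-*ˡ : ∀ {m n o} → ℕ.Coprime m o → ℕ.Coprime n o → ℕ.Coprime (m ℕ.* n) o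
coprime-*ˡ {m} {n} {o} m⊥o n⊥o {d} (d∣mn , d∣o) = m⊥o (d∣m , d∣o)
  where
  d⊥n : ℕ.Coprime d n
  d⊥n (e∣d , e∣n) = n⊥o (e∣n , ℕ.∣-trans e∣d d∣o)
  d∣m : d ℕ.∣ m
  d∣m = ℕ.coprime-divisor d⊥n (subst (d ℕ.∣_) (ℕ.*-comm m n) d∣mn)

coprime-*⇔ : ∀ i j k → Coprime (i * j) k ⇔ (Coprime i k × Coprime j k)
coprime-*⇔ i j k = mk⇔ split join
  where
  ∣ij∣≡ : ℤ.∣ i * j ∣ ≡ ℤ.∣ i ∣ ℕ.* ℤ.∣ j ∣
  ∣ij∣≡ = ℤ.abs-* i j
  split : Coprime (i * j) k → Coprime i k × Coprime j k
  split ij⊥k = coprime-∣ˡ (subst (ℤ.∣ i ∣ ℕ.∣_) (sym ∣ij∣≡) (ℕ.m∣m*n ℤ.∣ j ∣)) ij⊥k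
             , coprime-∣ˡ (subst (ℤ.∣ j ∣ ℕ.∣_) (sym ∣ij∣≡) (ℕ.n∣m*n ℤ.∣ i ∣)) ij⊥k
  join : Coprime i k × Coprime j k → Coprime (i * j) k
  join (i⊥k , j⊥k) = subst (λ n → ℕ.Coprime n ℤ.∣ k ∣) (sym ∣ij∣≡) (coprime-*ˡ i⊥k j⊥k)

coprime-^ : ∀ i k n → Coprime i k → Coprime (i ^ n) k
coprime-^ i k zero    i⊥k = ℕ.1-coprimeTo _
coprime-^ i k (suc n) i⊥k = from (coprime-*⇔ i (i ^ n) k) (i⊥k , coprime-^ i k n i⊥k)

coprime-*-^⇔ : ∀ i j k n → Coprime (i * j ^ suc n) k ⇔ Coprime (i * j) k
coprime-*-^⇔ i j k n = mk⇔ drop-power raise-power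
  where
  drop-power : Coprime (i * j ^ suc n) k → Coprime (i * j) k
  drop-power h with to (coprime-*⇔ i (j ^ suc n) k) h
  ... | i⊥k , jjⁿ⊥k = from (coprime-*⇔ i j k)
                        (i⊥k , proj₁ (to (coprime-*⇔ j (j ^ n) k) jjⁿ⊥k))
  raise-power : Coprime (i * j) k → Coprime (i * j ^ suc n) k
  raise-power h with to (coprime-*⇔ i j k) h
  ... | i⊥k , j⊥k = from (coprime-*⇔ i (j ^ suc n) k) (i⊥k , coprime-^ j k (suc n) j⊥k)

-- Congruences modulo N

-- Signed divisibility wrapped in a record: unlike the function _≡_[modℕ_],
-- its arguments can be inferred by unification.
infix 4 _≡_[mod_]
record _≡_[mod_] (x y : ℤ) (N : ℕ) : Set where
  constructor mod
  field modulus∣difference : + N ∣ x - y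

module _ {N : ℕ} where

  mod⇔modℕ : ∀ {x y} → x ≡ y [mod N ] ⇔ x ≡ y [modℕ N ]
  mod⇔modℕ {x} {y} = mk⇔ (λ (mod N∣x-y) → ∣⇒∣ᵤ N∣x-y) (mod ∘ ∣ᵤ⇒∣ {+ N} {x - y})

  mod-reflexive : ∀ {x y} → x ≡ y → x ≡ y [mod N ]
  mod-reflexive {x} refl = mod (divides 0ℤ (trans (ℤ.+-inverseʳ x) (sym (ℤ.*-zeroˡ (+ N)))))

  mod-sym : ∀ {x y} → x ≡ y [mod N ] → y ≡ x [mod N ]
  mod-sym {x} {y} (mod N∣x-y) = mod (subst (+ N ∣_) (negate-difference x y) (Signed.∣m⇒∣-m N∣x-y))
    where
    negate-difference : ∀ a b → - (a - b) ≡ b - a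
    negate-difference = solve-∀

  mod-trans : ∀ {x y z} → x ≡ y [mod N ] → y ≡ z [mod N ] → x ≡ z [mod N ]
  mod-trans {x} {y} {z} (mod N∣x-y) (mod N∣y-z) =
    mod (subst (+ N ∣_) (ℤ.+-minus-telescope x y z) (Signed.∣m∣n⇒∣m+n N∣x-y N∣y-z))

  mod-*-cong : ∀ {x y u v} → x ≡ y [mod N ] → u ≡ v [mod N ] → x * u ≡ y * v [mod N ]
  mod-*-cong {x} {y} {u} {v} (mod N∣x-y) (mod N∣u-v) = mod (subst (+ N ∣_) (sym (split x y u v))
    (Signed.∣m∣n⇒∣m+n (Signed.∣n⇒∣m*n x N∣u-v) (Signed.∣n⇒∣m*n v N∣x-y)))
    where
    split : ∀ a b c d → a * c - b * d ≡ a * (c - d) + d * (a - b)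
    split = solve-∀

  mod-*-congˡ : ∀ w {u v} → u ≡ v [mod N ] → w * u ≡ w * v [mod N ]
  mod-*-congˡ w = mod-*-cong (mod-reflexive {w} refl)

  mod-*-congʳ : ∀ w {u v} → u ≡ v [mod N ] → u * w ≡ v * w [mod N ]
  mod-*-congʳ w u≡v = mod-*-cong u≡v (mod-reflexive {w} refl)

  mod-^-cong : ∀ {x y} n → x ≡ y [mod N ] → x ^ n ≡ y ^ n [mod N ]
  mod-^-cong zero    x≡y = mod-reflexive refl
  mod-^-cong (suc n) x≡y = mod-*-cong x≡y (mod-^-cong n x≡y)

  mod-*-cancelˡ : ∀ i {x y} → Coprime i (+ N) → i * x ≡ i * y [mod N ] → x ≡ y [mod N ]
  mod-*-cancelˡ i {x} {y} i⊥N (mod N∣ix-iy) =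
    mod (∣ᵤ⇒∣ (coprime-divisor (+ N) i (x - y) (Coprime.sym {i} {+ N} i⊥N)
                 (∣⇒∣ᵤ (subst (+ N ∣_) (factor i x y) N∣ix-iy))))
    where
    factor : ∀ a b c → a * b - a * c ≡ a * (b - c)
    factor = solve-∀

  mod⇔≡-*N : ∀ {x y} → x ≡ y [mod N ] ⇔ ∃ λ k → x ≡ y - k * + N
  mod⇔≡-*N {x} {y} = mk⇔ as-multiple from-multiple
    where
    as-multiple : x ≡ y [mod N ] → ∃ λ k → x ≡ y - k * + N
    as-multiple (mod (divides q x-y≡qN)) = - q , (begin
      x                 ≡⟨ add-difference x y ⟩
      y + (x - y)       ≡⟨ cong (λ z → y + z) x-y≡qN ⟩
      y + q * + N       ≡⟨ add-as-subtract y q (+ N) ⟩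
      y - (- q) * + N   ∎)
      where
      open ≡-Reasoning
      add-difference : ∀ a b → a ≡ b + (a - b)
      add-difference = solve-∀
      add-as-subtract : ∀ b c n → b + c * n ≡ b - (- c) * n
      add-as-subtract = solve-∀
    from-multiple : (∃ λ k → x ≡ y - k * + N) → x ≡ y [mod N ]
    from-multiple (k , x≡y-kN) = mod (divides (- k) (trans (cong (_- y) x≡y-kN) (cancel y k (+ N))))
      where
      cancel : ∀ b c n → b - c * n - b ≡ (- c) * n
      cancel = solve-∀

x≡y-k*N⇒[x≡y⇔k≡0] : ∀ {N x y k} → 1 ≤ N → x ≡ y - k * + N → (x ≡ y ⇔ k ≡ 0ℤ)
x≡y-k*N⇒[x≡y⇔k≡0] {N} {x} {y} {k} N≥1 x≡y-kN = mk⇔ k≡0 x≡y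
  where
  k≡0 : x ≡ y → k ≡ 0ℤ
  k≡0 refl with ℤ.i*j≡0⇒i≡0∨j≡0 k kN≡0
    where
    open ≡-Reasoning
    kN≡0 : k * + N ≡ 0ℤ
    kN≡0 = begin
      k * + N              ≡⟨ subtract-twice x (k * + N) ⟩
      x - (x - k * + N)    ≡⟨ cong (λ z → x - z) x≡y-kN ⟨
      x - x                ≡⟨ ℤ.+-inverseʳ x ⟩
      0ℤ                   ∎
      where
      subtract-twice : ∀ a b → b ≡ a - (a - b)
      subtract-twice = solve-∀
  ... | inj₁ k≡0 = k≡0
  ... | inj₂ N≡0 = ⊥-elim (ℕ.<⇒≢ N≥1 (sym (ℤ.+-injective N≡0)))
  x≡y : k ≡ 0ℤ → x ≡ y
  x≡y refl = trans x≡y-kN (trans (cong (λ z → y - z) (ℤ.*-zeroˡ (+ N))) (ℤ.+-identityʳ y))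

mod-setoid : ℕ → Setoid _ _
mod-setoid N = record
  { Carrier = ℤ
  ; _≈_ = λ x y → x ≡ y [mod N ]
  ; isEquivalence = record { refl = mod-reflexive refl ; sym = mod-sym ; trans = mod-trans }
  }

∃-inverse-mod : ∀ {N} i → Coprime i (+ N) → ∃ λ u → i * u ≡ 1ℤ [mod N ]
∃-inverse-mod {N} (+ n) n⊥N with ℕ.coprime-Bézout n⊥N
... | Bézout.+- x y 1+yN≡xn = + x , mod (divides (+ y) (begin
  + n * + x - 1ℤ     ≡⟨ cong (_- 1ℤ) (trans (ℤ.*-comm (+ n) (+ x)) (sym (ℤ.pos-* x n))) ⟩
  + (x ℕ.* n) - 1ℤ   ≡⟨ cong (λ z → + z - 1ℤ) (sym 1+yN≡xn) ⟩
  + (1 ℕ.+ y ℕ.* N) - 1ℤ ≡⟨ cong (_- 1ℤ) (trans (ℤ.pos-+ 1 (y ℕ.* N)) (cong (λ z → 1ℤ + z) (ℤ.pos-* y N))) ⟩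
  1ℤ + + y * + N - 1ℤ ≡⟨ one-cancels (+ y * + N) ⟩
  + y * + N ∎))
  where
  open ≡-Reasoning
  one-cancels : ∀ a → 1ℤ + a - 1ℤ ≡ a
  one-cancels = solve-∀
... | Bézout.-+ x y 1+xn≡yN = - + x , mod (divides (- + y) (begin
  + n * - + x - 1ℤ     ≡⟨ negate-sum (+ n) (+ x) ⟩
  - (1ℤ + + x * + n)   ≡⟨ cong (λ z → - (1ℤ + z)) (sym (ℤ.pos-* x n)) ⟩
  - (1ℤ + + (x ℕ.* n)) ≡⟨ cong -_ (sym (ℤ.pos-+ 1 (x ℕ.* n))) ⟩
  - + (1 ℕ.+ x ℕ.* n)  ≡⟨ cong (λ z → - + z) 1+xn≡yN ⟩
  - + (y ℕ.* N)        ≡⟨ cong -_ (ℤ.pos-* y N) ⟩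
  - (+ y * + N)        ≡⟨ ℤ.neg-distribˡ-* (+ y) (+ N) ⟩
  - + y * + N ∎))
  where
  open ≡-Reasoning
  negate-sum : ∀ a b → a * - b - 1ℤ ≡ - (1ℤ + b * a)
  negate-sum = solve-∀
∃-inverse-mod {N} -[1+ n ] n⊥N with ∃-inverse-mod {N} +[1+ n ] n⊥N
... | u , mod N∣nu-1 = - u , mod (subst (λ z → + N ∣ z - 1ℤ) (negate-both +[1+ n ] u) N∣nu-1)
  where
  negate-both : ∀ a b → a * b ≡ (- a) * (- b)
  negate-both = solve-∀

-- Rational progressions as integer identities

-- ℚ stores reduced fractions, so numerators and denominators are tracked in ℚᵘ.
↥-*ᵘ : ∀ p q → ℚᵘ.↥ (p ℚᵘ.* q) ≡ ℚᵘ.↥ p * ℚᵘ.↥ q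
↥-*ᵘ (mkℚᵘ _ _) (mkℚᵘ _ _) = refl

↧-*ᵘ : ∀ p q → ℚᵘ.↧ (p ℚᵘ.* q) ≡ ℚᵘ.↧ p * ℚᵘ.↧ q
↧-*ᵘ p@(mkℚᵘ _ _) q@(mkℚᵘ _ _) = ℤ.pos-* (ℚᵘ.↧ₙ p) (ℚᵘ.↧ₙ q)

↥-^ᵘ : ∀ q n → ℚᵘ.↥ (q ^ᵘ n) ≡ ℚᵘ.↥ q ^ n
↥-^ᵘ q zero    = refl
↥-^ᵘ q (suc n) = trans (↥-*ᵘ q (q ^ᵘ n)) (cong (ℚᵘ.↥ q *_) (↥-^ᵘ q n))

↧-^ᵘ : ∀ q n → ℚᵘ.↧ (q ^ᵘ n) ≡ ℚᵘ.↧ q ^ n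
↧-^ᵘ q zero    = refl
↧-^ᵘ q (suc n) = trans (↧-*ᵘ q (q ^ᵘ n)) (cong (ℚᵘ.↧ q *_) (↧-^ᵘ q n))

toℚᵘ-homo-^ : ∀ p n → ℚ.toℚᵘ (p ^ℚ n) ℚᵘ.≃ ℚ.toℚᵘ p ^ᵘ n
toℚᵘ-homo-^ p zero    = ℚᵘ.≃-refl
toℚᵘ-homo-^ p (suc n) = ℚᵘ.≃-trans (ℚ.toℚᵘ-homo-* p (p ^ℚ n))
                                   (ℚᵘ.*-congˡ {ℚ.toℚᵘ p} (toℚᵘ-homo-^ p n))

toℚ≡toℚ*^⇔ : ∀ x y ρ n → toℚ x ≡ toℚ y ℚ.* ρ ^ℚ n ⇔ x * ℚ.↧ ρ ^ n ≡ y * ℚ.↥ ρ ^ n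
toℚ≡toℚ*^⇔ x y ρ n = mk⇔
  (λ eq → cross (ℚᵘ.≃-trans (ℚᵘ.≃-sym x≃) (ℚᵘ.≃-trans (ℚ.toℚᵘ-cong eq) rhs≃)))
  (λ eq → ℚ.toℚᵘ-injective (ℚᵘ.≃-trans x≃ (ℚᵘ.≃-trans (uncross eq) (ℚᵘ.≃-sym rhs≃))))
  where
  ρᵘ = ℚ.toℚᵘ ρ
  rhs = mkℚᵘ y 0 ℚᵘ.* ρᵘ ^ᵘ n
  x≃ : ℚ.toℚᵘ (toℚ x) ℚᵘ.≃ mkℚᵘ x 0
  x≃ = ℚ.toℚᵘ-fromℚᵘ (mkℚᵘ x 0)
  rhs≃ : ℚ.toℚᵘ (toℚ y ℚ.* ρ ^ℚ n) ℚᵘ.≃ rhs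
  rhs≃ = ℚᵘ.≃-trans (ℚ.toℚᵘ-homo-* (toℚ y) (ρ ^ℚ n))
                    (ℚᵘ.*-cong (ℚ.toℚᵘ-fromℚᵘ (mkℚᵘ y 0)) (toℚᵘ-homo-^ ρ n))
  ↥rhs : ℚᵘ.↥ rhs ≡ y * ℚ.↥ ρ ^ n
  ↥rhs = trans (↥-*ᵘ (mkℚᵘ y 0) (ρᵘ ^ᵘ n))
               (cong (y *_) (trans (↥-^ᵘ ρᵘ n) (cong (_^ n) (ℚ.↥ᵘ-toℚᵘ ρ))))
  ↧rhs : ℚᵘ.↧ rhs ≡ ℚ.↧ ρ ^ n
  ↧rhs = trans (↧-*ᵘ (mkℚᵘ y 0) (ρᵘ ^ᵘ n))
               (trans (ℤ.*-identityˡ _) (trans (↧-^ᵘ ρᵘ n) (cong (_^ n) (ℚ.↧ᵘ-toℚᵘ ρ))))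
  cross : mkℚᵘ x 0 ℚᵘ.≃ rhs → x * ℚ.↧ ρ ^ n ≡ y * ℚ.↥ ρ ^ n
  cross x≃rhs = begin
    x * ℚ.↧ ρ ^ n        ≡⟨ cong (x *_) ↧rhs ⟨
    x * ℚᵘ.↧ rhs         ≡⟨ ℚᵘ.drop-*≡* x≃rhs ⟩
    ℚᵘ.↥ rhs * 1ℤ        ≡⟨ ℤ.*-identityʳ _ ⟩
    ℚᵘ.↥ rhs             ≡⟨ ↥rhs ⟩
    y * ℚ.↥ ρ ^ n        ∎
    where open ≡-Reasoning
  uncross : x * ℚ.↧ ρ ^ n ≡ y * ℚ.↥ ρ ^ n → mkℚᵘ x 0 ℚᵘ.≃ rhs
  uncross eq = *≡* (begin
    x * ℚᵘ.↧ rhs         ≡⟨ cong (x *_) ↧rhs ⟩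
    x * ℚ.↧ ρ ^ n        ≡⟨ eq ⟩
    y * ℚ.↥ ρ ^ n        ≡⟨ ↥rhs ⟨
    ℚᵘ.↥ rhs             ≡⟨ ℤ.*-identityʳ _ ⟨
    ℚᵘ.↥ rhs * 1ℤ        ∎)
    where open ≡-Reasoning

data InitOrLast : ∀ {n} → Fin (suc n) → Set where
  init : ∀ {n} (j : Fin n) → InitOrLast (inject₁ j)
  last : ∀ {n} → InitOrLast (fromℕ n)

initOrLast : ∀ {n} (i : Fin (suc n)) → InitOrLast i
initOrLast {zero}  zero    = last
initOrLast {suc n} zero    = init zero
initOrLast {suc n} (Fin.suc i) with initOrLast i
... | init j = init (Fin.suc j)
... | last   = last

∀⇔∀-inject₁×fromℕ : ∀ {n} {P : Fin (suc n) → Set} →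
                    (∀ i → P i) ⇔ ((∀ j → P (inject₁ j)) × P (fromℕ n))
∀⇔∀-inject₁×fromℕ {P = P} = mk⇔ (λ all → all ∘ inject₁ , all (fromℕ _)) both
  where
  both : _ → ∀ i → P i
  both (init-holds , last-holds) i with initOrLast i
  ... | init j = init-holds j
  ... | last   = last-holds

HasRatio : ∀ {n} → (Fin (suc n) → ℤ) → ℤ → ℤ → Set
HasRatio c x y = ∀ i → c i * y ^ toℕ i ≡ c zero * x ^ toℕ i

ratGeomProg⇔hasRatio : ∀ {n} {c : Fin (suc n) → ℤ} →
                       RatGeomProg c ⇔ ∃ λ ρ → HasRatio c (ℚ.↥ ρ) (ℚ.↧ ρ)
ratGeomProg⇔hasRatio {c = c} = mk⇔
  (λ (ρ , eq) → ρ , λ i → to (toℚ≡toℚ*^⇔ (c i) (c zero) ρ (toℕ i)) (eq i))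
  (λ (ρ , h) → ρ , λ i → from (toℚ≡toℚ*^⇔ (c i) (c zero) ρ (toℕ i)) (h i))

hasRatio-rescale : ∀ {n} {c : Fin (suc n) → ℤ} x y x′ y′ →
                   y ≢ 0ℤ → x′ * y ≡ x * y′ → HasRatio c x y → HasRatio c x′ y′
hasRatio-rescale {c = c} x y x′ y′ y≢0 x′y≡xy′ h i =
  *-cancelʳ-≢0 _ _ (^-≢0 t y≢0) (begin
    c i * y′ ^ t * y ^ t      ≡⟨ swap₂₃ (c i) (y′ ^ t) (y ^ t) ⟩
    c i * y ^ t * y′ ^ t      ≡⟨ cong (_* y′ ^ t) (h i) ⟩
    c zero * x ^ t * y′ ^ t   ≡⟨ ℤ.*-assoc (c zero) (x ^ t) (y′ ^ t) ⟩
    c zero * (x ^ t * y′ ^ t) ≡⟨ cong (c zero *_) (^-distribʳ-* x y′ t) ⟨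
    c zero * (x * y′) ^ t     ≡⟨ cong (λ z → c zero * z ^ t) x′y≡xy′ ⟨
    c zero * (x′ * y) ^ t     ≡⟨ cong (c zero *_) (^-distribʳ-* x′ y t) ⟩
    c zero * (x′ ^ t * y ^ t) ≡⟨ ℤ.*-assoc (c zero) (x′ ^ t) (y ^ t) ⟨
    c zero * x′ ^ t * y ^ t   ∎)
  where
  open ≡-Reasoning
  t = toℕ i
  swap₂₃ : ∀ a b c → a * b * c ≡ a * c * b
  swap₂₃ = solve-∀

∃-fraction : ∀ x {y} → y ≢ 0ℤ → ∃ λ ρ → ℚ.↥ ρ * y ≡ x * ℚ.↧ ρ
∃-fraction x {+[1+ n ]} _ = numerator-cross (mkℚᵘ x n)
  where
  numerator-cross : ∀ q → ∃ λ ρ → ℚ.↥ ρ * ℚᵘ.↧ q ≡ ℚᵘ.↥ q * ℚ.↧ ρ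
  numerator-cross q = ℚ.fromℚᵘ q , subst₂ (λ u v → u * ℚᵘ.↧ q ≡ ℚᵘ.↥ q * v)
    (ℚ.↥ᵘ-toℚᵘ (ℚ.fromℚᵘ q)) (ℚ.↧ᵘ-toℚᵘ (ℚ.fromℚᵘ q)) (ℚᵘ.drop-*≡* (ℚ.toℚᵘ-fromℚᵘ q))
∃-fraction x {+ 0} 0≢0 = ⊥-elim (0≢0 refl)
∃-fraction x { -[1+ n ]} _ with ∃-fraction (- x) {+[1+ n ]} (λ ())
... | ρ , ↥ρn≡-x↧ρ = ρ , (begin
  ℚ.↥ ρ * -[1+ n ]         ≡⟨ ℤ.neg-distribʳ-* (ℚ.↥ ρ) +[1+ n ] ⟨
  - (ℚ.↥ ρ * +[1+ n ])     ≡⟨ cong -_ ↥ρn≡-x↧ρ ⟩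
  - (- x * ℚ.↧ ρ)          ≡⟨ cong -_ (ℤ.neg-distribˡ-* x (ℚ.↧ ρ)) ⟨
  - - (x * ℚ.↧ ρ)          ≡⟨ ℤ.neg-involutive (x * ℚ.↧ ρ) ⟩
  x * ℚ.↧ ρ                ∎)
  where open ≡-Reasoning

hasRatio⇒ratGeomProg : ∀ {n} {c : Fin (suc n) → ℤ} {x y} →
                       y ≢ 0ℤ → HasRatio c x y → RatGeomProg c
hasRatio⇒ratGeomProg {c = c} {x} y≢0 h with ∃-fraction x y≢0
... | ρ , ↥ρy≡x↧ρ = from (ratGeomProg⇔hasRatio {c = c}) (ρ , hasRatio-rescale {c = c} x _ (ℚ.↥ ρ) (ℚ.↧ ρ) y≢0 ↥ρy≡x↧ρ h)

ratGeomProg⇒coprimeRatio : ∀ {n} {c : Fin (suc n) → ℤ} → RatGeomProg c →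
  ∃ λ x → ∃ λ y → y ≢ 0ℤ × Coprime x y × HasRatio c x y
ratGeomProg⇒coprimeRatio {c = c} rg with to (ratGeomProg⇔hasRatio {c = c}) rg
... | ℚ.mkℚ x y-1 x⊥y , h = x , +[1+ y-1 ] , (λ ()) , ℕ.recompute x⊥y , h

hasRatio-last : ∀ {n} {c : Fin (suc n) → ℤ} {x y} →
                HasRatio c x y → c (fromℕ n) * y ^ n ≡ c zero * x ^ n
hasRatio-last {n} {c} {x} {y} h =
  subst (λ t → c (fromℕ n) * y ^ t ≡ c zero * x ^ t) (Fin.toℕ-fromℕ n) (h (fromℕ n))

coprimeRatio⇒^∣head : ∀ {s} {b : Fin (suc s) → ℤ} m p → Coprime m p → HasRatio b m p → p ^ s ∣ b zero
coprimeRatio⇒^∣head {s} {b} m p m⊥p h = ∣ᵤ⇒∣ (coprime-divisor (p ^ s) (m ^ s) (b zero) pˢ⊥mˢ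
  (∣⇒∣ᵤ (divides (b (fromℕ s)) (trans (ℤ.*-comm (m ^ s) (b zero)) (sym (hasRatio-last {c = b} h))))))
  where
  pˢ⊥mˢ : Coprime (p ^ s) (m ^ s)
  pˢ⊥mˢ = coprime-^ p (m ^ s) s (Coprime.sym {m ^ s} {p} (coprime-^ m p s m⊥p))

hasRatio-snoc : ∀ {n} {c : Fin (2 ℕ.+ n) → ℤ} {x y} →
                HasRatio (c ∘ inject₁) x y → c (fromℕ (suc n)) * y ^ suc n ≡ c zero * x ^ suc n →
                HasRatio c x y
hasRatio-snoc {n} {c} {x} {y} h l i with initOrLast i
... | init j = subst (λ t → c (inject₁ j) * y ^ t ≡ c zero * x ^ t) (sym (Fin.toℕ-inject₁ j)) (h j)
... | last   = subst (λ t → c (fromℕ (suc n)) * y ^ t ≡ c zero * x ^ t) (sym (Fin.toℕ-fromℕ (suc n))) l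

-- The shape [a pˢ, a pˢ⁻¹ m, …, a mˢ]

HomogeneousGP : ∀ {s} → ℤ → ℤ → ℤ → (Fin (suc s) → ℤ) → Set
HomogeneousGP {s} a p m b = ∀ j → b j ≡ a * p ^ (s ∸ toℕ j) * m ^ toℕ j

homogeneous-*-^ : ∀ a p m {s t} → t ≤ s → a * p ^ (s ∸ t) * m ^ t * p ^ t ≡ a * p ^ s * m ^ t
homogeneous-*-^ a p m {s} {t} t≤s = begin
  a * p ^ (s ∸ t) * m ^ t * p ^ t   ≡⟨ regroup a (p ^ (s ∸ t)) (m ^ t) (p ^ t) ⟩
  a * (p ^ (s ∸ t) * p ^ t) * m ^ t ≡⟨ cong (λ z → a * z * m ^ t) (^∸-*-^ p t≤s) ⟩
  a * p ^ s * m ^ t                 ∎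
  where
  open ≡-Reasoning
  regroup : ∀ w x y z → w * x * y * z ≡ w * (x * z) * y
  regroup = solve-∀

module _ {s} {b : Fin (suc s) → ℤ} (a p m : ℤ) where

  homogeneous-head : HomogeneousGP a p m b → b zero ≡ a * p ^ s
  homogeneous-head hom = trans (hom zero) (ℤ.*-identityʳ (a * p ^ s))

  homogeneous⇒hasRatio : HomogeneousGP a p m b → HasRatio b m p
  homogeneous⇒hasRatio hom j = begin
    b j * p ^ toℕ j                                 ≡⟨ cong (_* p ^ toℕ j) (hom j) ⟩
    a * p ^ (s ∸ toℕ j) * m ^ toℕ j * p ^ toℕ j     ≡⟨ homogeneous-*-^ a p m (Fin.toℕ≤pred[n] j) ⟩
    a * p ^ s * m ^ toℕ j                           ≡⟨ cong (_* m ^ toℕ j) (homogeneous-head hom) ⟨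
    b zero * m ^ toℕ j                              ∎
    where open ≡-Reasoning

  hasRatio⇒homogeneous : p ≢ 0ℤ → b zero ≡ a * p ^ s → HasRatio b m p → HomogeneousGP a p m b
  hasRatio⇒homogeneous p≢0 b₀≡ h j = *-cancelʳ-≢0 _ _ (^-≢0 (toℕ j) p≢0) (begin
    b j * p ^ toℕ j                                 ≡⟨ h j ⟩
    b zero * m ^ toℕ j                              ≡⟨ cong (_* m ^ toℕ j) b₀≡ ⟩
    a * p ^ s * m ^ toℕ j                           ≡⟨ homogeneous-*-^ a p m (Fin.toℕ≤pred[n] j) ⟨
    a * p ^ (s ∸ toℕ j) * m ^ toℕ j * p ^ toℕ j     ∎)
    where open ≡-Reasoning

  homogeneous-≢0 : a ≢ 0ℤ → p ≢ 0ℤ → m ≢ 0ℤ → HomogeneousGP a p m b → ∀ j → b j ≢ 0ℤ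
  homogeneous-≢0 a≢0 p≢0 m≢0 hom j rewrite hom j =
    *-≢0 (*-≢0 a≢0 (^-≢0 (s ∸ toℕ j) p≢0)) (^-≢0 (toℕ j) m≢0)

ratGeomProg⇒homogeneous : ∀ {s} {b : Fin (suc s) → ℤ} → RatGeomProg b →
  ∃ λ a → ∃ λ p → ∃ λ m → p ≢ 0ℤ × Coprime m p × HomogeneousGP a p m b
ratGeomProg⇒homogeneous {s} {b} rg with ratGeomProg⇒coprimeRatio {c = b} rg
... | m , p , p≢0 , m⊥p , h with coprimeRatio⇒^∣head {b = b} m p m⊥p h
... | divides a b₀≡apˢ = a , p , m , p≢0 , m⊥p , hasRatio⇒homogeneous a p m p≢0 b₀≡apˢ h

homogeneous-≢0⇔ : ∀ {e} {b : Fin (2 ℕ.+ e) → ℤ} a p m → p ≢ 0ℤ → HomogeneousGP a p m b →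
                  (∀ j → b j ≢ 0ℤ) ⇔ (a ≢ 0ℤ × m ≢ 0ℤ)
homogeneous-≢0⇔ {e} {b} a p m p≢0 hom = mk⇔ factors-≢0 (λ (a≢0 , m≢0) → homogeneous-≢0 a p m a≢0 p≢0 m≢0 hom)
  where
  factors-≢0 : (∀ j → b j ≢ 0ℤ) → a ≢ 0ℤ × m ≢ 0ℤ
  factors-≢0 b≢0 = *≢0⇒≢0ˡ (p ^ suc e) (subst (_≢ 0ℤ) (homogeneous-head a p m hom) (b≢0 zero))
                 , *≢0⇒≢0ˡ 1ℤ (*≢0⇒≢0ʳ (a * p ^ e) (subst (_≢ 0ℤ) (hom (Fin.suc zero)) (b≢0 (Fin.suc zero))))

homogeneous-head-coprime⇔ : ∀ {e} {b : Fin (2 ℕ.+ e) → ℤ} a p m k → HomogeneousGP a p m b →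
                            Coprime (b zero) k ⇔ Coprime (a * p) k
homogeneous-head-coprime⇔ {e} {b} a p m k hom =
  subst (λ z → Coprime z k ⇔ Coprime (a * p) k) (sym (homogeneous-head a p m hom))
        (coprime-*-^⇔ a p k e)

module _ {e} {c : Fin (3 ℕ.+ e) → ℤ} (a p m : ℤ) (hom : HomogeneousGP a p m (c ∘ inject₁)) where

  private
    s d : ℕ
    s = suc e
    d = suc s
    q = c (fromℕ d)

    c₀≡ : c zero ≡ a * p ^ s
    c₀≡ = homogeneous-head a p m hom

    c₁≡ : c (Fin.suc zero) ≡ a * p ^ e * m
    c₁≡ = trans (hom (Fin.suc zero)) (cong (a * p ^ e *_) (ℤ.*-identityʳ m))

    last-cross : p * q ≡ a * m ^ d → q * p ^ d ≡ c zero * m ^ d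
    last-cross pq≡ = begin
      q * (p * p ^ s)        ≡⟨ regroup q p (p ^ s) ⟩
      p * q * p ^ s          ≡⟨ cong (_* p ^ s) pq≡ ⟩
      a * m ^ d * p ^ s      ≡⟨ swap₂₃ a (m ^ d) (p ^ s) ⟩
      a * p ^ s * m ^ d      ≡⟨ cong (_* m ^ d) c₀≡ ⟨
      c zero * m ^ d         ∎
      where
      open ≡-Reasoning
      regroup : ∀ x y z → x * (y * z) ≡ y * x * z
      regroup = solve-∀
      swap₂₃ : ∀ x y z → x * y * z ≡ x * z * y
      swap₂₃ = solve-∀

  p*last≡a*mᵈ⇒ratGeomProg : p ≢ 0ℤ → p * q ≡ a * m ^ d → RatGeomProg c
  p*last≡a*mᵈ⇒ratGeomProg p≢0 pq≡ = hasRatio⇒ratGeomProg {c = c} p≢0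
    (hasRatio-snoc {c = c} (homogeneous⇒hasRatio {b = c ∘ inject₁} a p m hom) (last-cross pq≡))

  ratGeomProg⇒p*last≡a*mᵈ : a ≢ 0ℤ → p ≢ 0ℤ → RatGeomProg c → p * q ≡ a * m ^ d
  ratGeomProg⇒p*last≡a*mᵈ a≢0 p≢0 rg with ratGeomProg⇒coprimeRatio {c = c} rg
  ... | x , y , y≢0 , _ , h = *-cancelʳ-≢0 _ _ (^-≢0 s p≢0) (begin
    p * q * p ^ s          ≡⟨ regroup p q (p ^ s) ⟩
    q * p ^ d              ≡⟨ hasRatio-last {c = c} (hasRatio-rescale {c = c} x y m p y≢0 my≡xp h) ⟩
    c zero * m ^ d         ≡⟨ cong (_* m ^ d) c₀≡ ⟩
    a * p ^ s * m ^ d      ≡⟨ swap₂₃ a (p ^ s) (m ^ d) ⟩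
    a * m ^ d * p ^ s      ∎)
    where
    open ≡-Reasoning
    regroup : ∀ x y z → x * y * z ≡ y * (x * z)
    regroup = solve-∀
    swap₂₃ : ∀ x y z → x * y * z ≡ x * z * y
    swap₂₃ = solve-∀
    my≡xp : m * y ≡ x * p
    my≡xp = *-cancelˡ-≢0 _ _ (*-≢0 a≢0 (^-≢0 e p≢0)) (begin
      a * p ^ e * (m * y)         ≡⟨ left a (p ^ e) m y ⟩
      a * p ^ e * m * (y * 1ℤ)    ≡⟨ cong (_* (y * 1ℤ)) c₁≡ ⟨
      c (Fin.suc zero) * y ^ 1    ≡⟨ h (Fin.suc zero) ⟩
      c zero * x ^ 1              ≡⟨ cong (_* (x * 1ℤ)) c₀≡ ⟩
      a * (p * p ^ e) * (x * 1ℤ)  ≡⟨ right a (p ^ e) p x ⟩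
      a * p ^ e * (x * p)         ∎)
      where
      left : ∀ w u v z → w * u * (v * z) ≡ w * u * v * (z * 1ℤ)
      left = solve-∀
      right : ∀ w u v z → w * (v * u) * (z * 1ℤ) ≡ w * u * (z * v)
      right = solve-∀

  ratGeomProg⇔p*last≡a*mᵈ : a ≢ 0ℤ → p ≢ 0ℤ → RatGeomProg c ⇔ p * q ≡ a * m ^ d
  ratGeomProg⇔p*last≡a*mᵈ a≢0 p≢0 =
    mk⇔ (ratGeomProg⇒p*last≡a*mᵈ a≢0 p≢0) (p*last≡a*mᵈ⇒ratGeomProg p≢0)

  geomProgMod⇒p*last≡a*mᵈ : ∀ {N} → Coprime (a * p) (+ N) →
                            GeomProgMod N c → p * q ≡ a * m ^ d [mod N ]
  geomProgMod⇒p*last≡a*mᵈ {N} ap⊥N (r , h) = begin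
    p * q                   ≈⟨ mod-*-congˡ p last≡ ⟩
    p * (c zero * r ^ d)    ≡⟨ cong (λ z → p * (z * r ^ d)) c₀≡ ⟩
    p * (a * p ^ s * r ^ d) ≡⟨ regroup p a (p ^ s) (r ^ d) ⟩
    a * (p ^ d * r ^ d)     ≡⟨ cong (a *_) (^-distribʳ-* p r d) ⟨
    a * (p * r) ^ d         ≈⟨ mod-*-congˡ a (mod-^-cong d (mod-sym m≡pr)) ⟩
    a * m ^ d               ∎
    where
    open SetoidReasoning (mod-setoid N)
    regroup : ∀ w x y z → w * (x * y * z) ≡ x * (w * y * z)
    regroup = solve-∀
    last≡ : q ≡ c zero * r ^ d [mod N ]
    last≡ = from mod⇔modℕ (subst (λ t → q ≡ (c zero * r ^ t) [modℕ N ]) (Fin.toℕ-fromℕ d) (h (fromℕ d)))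
    apᵉ⊥N : Coprime (a * p ^ e) (+ N)
    apᵉ⊥N with to (coprime-*⇔ a p (+ N)) ap⊥N
    ... | a⊥N , p⊥N = from (coprime-*⇔ a (p ^ e) (+ N)) (a⊥N , coprime-^ p (+ N) e p⊥N)
    m≡pr : m ≡ p * r [mod N ]
    m≡pr = mod-*-cancelˡ (a * p ^ e) apᵉ⊥N (begin
      a * p ^ e * m              ≡⟨ c₁≡ ⟨
      c (Fin.suc zero)           ≈⟨ from mod⇔modℕ (h (Fin.suc zero)) ⟩
      c zero * (r * 1ℤ)          ≡⟨ cong (_* (r * 1ℤ)) c₀≡ ⟩
      a * (p * p ^ e) * (r * 1ℤ) ≡⟨ regroup′ a (p ^ e) p r ⟩
      a * p ^ e * (p * r)        ∎)
      where
      regroup′ : ∀ w u v z → w * (v * u) * (z * 1ℤ) ≡ w * u * (v * z)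
      regroup′ = solve-∀

  p*last≡a*mᵈ⇒geomProgMod : ∀ {N} → Coprime p (+ N) →
                            p * q ≡ a * m ^ d [mod N ] → GeomProgMod N c
  p*last≡a*mᵈ⇒geomProgMod {N} p⊥N pq≡ with ∃-inverse-mod p p⊥N
  ... | u , pu≡1 = m * u , λ i → to mod⇔modℕ (entry i)
    where
    open SetoidReasoning (mod-setoid N)
    entry : ∀ i → c i ≡ c zero * (m * u) ^ toℕ i [mod N ]
    entry i with initOrLast i
    ... | init j = subst (λ t → c (inject₁ j) ≡ c zero * (m * u) ^ t [mod N ]) (sym (Fin.toℕ-inject₁ j)) (begin
      c (inject₁ j)                             ≡⟨ hom j ⟩
      b                                         ≡⟨ ℤ.*-identityʳ b ⟨
      b * 1ℤ                                    ≡⟨ cong (b *_) (ℤ.^-zeroˡ t) ⟨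
      b * 1ℤ ^ t                                ≈⟨ mod-*-congˡ b (mod-^-cong t (mod-sym pu≡1)) ⟩
      b * (p * u) ^ t                           ≡⟨ cong (b *_) (^-distribʳ-* p u t) ⟩
      b * (p ^ t * u ^ t)                       ≡⟨ ℤ.*-assoc b (p ^ t) (u ^ t) ⟨
      b * p ^ t * u ^ t                         ≡⟨ cong (_* u ^ t) (homogeneous-*-^ a p m (Fin.toℕ≤pred[n] j)) ⟩
      a * p ^ s * m ^ t * u ^ t                 ≡⟨ ℤ.*-assoc (a * p ^ s) (m ^ t) (u ^ t) ⟩
      a * p ^ s * (m ^ t * u ^ t)               ≡⟨ cong₂ _*_ c₀≡ (^-distribʳ-* m u t) ⟨
      c zero * (m * u) ^ t                      ∎)
      where
      t = toℕ j
      b = a * p ^ (s ∸ t) * m ^ t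
    ... | last = subst (λ t → q ≡ c zero * (m * u) ^ t [mod N ]) (sym (Fin.toℕ-fromℕ d)) (begin
      q                                  ≡⟨ ℤ.*-identityˡ q ⟨
      1ℤ * q                             ≡⟨ cong (_* q) (ℤ.^-zeroˡ d) ⟨
      1ℤ ^ d * q                         ≈⟨ mod-*-congʳ q (mod-^-cong d (mod-sym pu≡1)) ⟩
      (p * u) ^ d * q                    ≡⟨ cong (_* q) (^-distribʳ-* p u d) ⟩
      p ^ d * u ^ d * q                  ≡⟨ regroup p (p ^ s) (u ^ d) q ⟩
      p ^ s * u ^ d * (p * q)            ≈⟨ mod-*-congˡ (p ^ s * u ^ d) pq≡ ⟩
      p ^ s * u ^ d * (a * m ^ d)        ≡⟨ regroup′ (p ^ s) (u ^ d) a (m ^ d) ⟩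
      a * p ^ s * (m ^ d * u ^ d)        ≡⟨ cong₂ _*_ c₀≡ (^-distribʳ-* m u d) ⟨
      c zero * (m * u) ^ d               ∎)
      where
      regroup : ∀ x y z w → x * y * z * w ≡ y * z * (x * w)
      regroup = solve-∀
      regroup′ : ∀ x y z w → x * y * (z * w) ≡ z * x * (w * y)
      regroup′ = solve-∀

  geomProgMod⇔p*last≡a*mᵈ : ∀ {N} → Coprime (a * p) (+ N) →
                            GeomProgMod N c ⇔ p * q ≡ a * m ^ d [mod N ]
  geomProgMod⇔p*last≡a*mᵈ {N} ap⊥N = mk⇔ (geomProgMod⇒p*last≡a*mᵈ ap⊥N)
    (p*last≡a*mᵈ⇒geomProgMod (proj₂ (to (coprime-*⇔ a p (+ N)) ap⊥N)))

theorem4p1 : (N : ℕ) → 1 ≤ N → (d : ℕ) → 2 ≤ d → (c : Fin (suc d) → ℤ) →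
  (GeomProgMod N c
    × (∀ (i : Fin (suc d)) → c i ≢ + 0)
    × gcd (c zero) (+ N) ≡ + 1
    × RatGeomProg (λ (i : Fin d) → c (inject₁ i))
    × ¬ RatGeomProg c)
  ⇔
  (∃ λ (a : ℤ) → ∃ λ (p : ℤ) → ∃ λ (m : ℤ) → ∃ λ (k : ℤ) →
    a ≢ + 0 × p ≢ + 0 × m ≢ + 0 × k ≢ + 0
    × gcd m p ≡ + 1
    × gcd (a * p) (+ N) ≡ + 1
    × (∃ λ (q : ℤ) → q ≢ + 0 × p * q ≡ a * m ^ d - k * + N
        × c (fromℕ d) ≡ q)
    × (∀ (i : Fin d) → c (inject₁ i) ≡ a * p ^ (d ∸ 1 ∸ toℕ i) * m ^ toℕ i))
theorem4p1 N N≥1 (suc (suc e)) (ℕ.s≤s (ℕ.s≤s ℕ.z≤n)) c = mk⇔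
  (λ (gp , c≢0 , gcd[c₀,N]≡1 , rg-init , ¬rg) →
    case ratGeomProg⇒homogeneous {b = c ∘ inject₁} rg-init of λ (a , p , m , p≢0 , m⊥p , hom) →
    case to (homogeneous-≢0⇔ {b = c ∘ inject₁} a p m p≢0 hom) (λ j → c≢0 (inject₁ j)) of λ (a≢0 , m≢0) →
    let ap⊥N = to (homogeneous-head-coprime⇔ {b = c ∘ inject₁} a p m (+ N) hom)
                  (from (coprime⇔gcd≡1 {c zero} {+ N}) gcd[c₀,N]≡1) in
    case to mod⇔≡-*N (to (geomProgMod⇔p*last≡a*mᵈ {c = c} a p m hom {N} ap⊥N) gp) of λ (k , pq≡) →
      a , p , m , k , a≢0 , p≢0 , m≢0
    , (λ k≡0 → ¬rg (from (ratGeomProg⇔p*last≡a*mᵈ {c = c} a p m hom a≢0 p≢0)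
                         (from (x≡y-k*N⇒[x≡y⇔k≡0] {k = k} N≥1 pq≡) k≡0)))
    , to (coprime⇔gcd≡1 {m} {p}) m⊥p , to (coprime⇔gcd≡1 {a * p} {+ N}) ap⊥N
    , (_ , c≢0 (fromℕ _) , pq≡ , refl) , hom)
  (λ where
    (a , p , m , k , a≢0 , p≢0 , m≢0 , k≢0 , _ , gcd[ap,N]≡1 , (_ , q≢0 , pq≡ , refl) , hom) →
      let ap⊥N = from (coprime⇔gcd≡1 {a * p} {+ N}) gcd[ap,N]≡1 in
        from (geomProgMod⇔p*last≡a*mᵈ {c = c} a p m hom {N} ap⊥N) (from mod⇔≡-*N (k , pq≡))
      , from (∀⇔∀-inject₁×fromℕ {P = λ i → c i ≢ 0ℤ})
             (from (homogeneous-≢0⇔ {b = c ∘ inject₁} a p m p≢0 hom) (a≢0 , m≢0) , q≢0)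
      , to (coprime⇔gcd≡1 {c zero} {+ N})
           (from (homogeneous-head-coprime⇔ {b = c ∘ inject₁} a p m (+ N) hom) ap⊥N)
      , hasRatio⇒ratGeomProg {c = c ∘ inject₁} p≢0 (homogeneous⇒hasRatio {b = c ∘ inject₁} a p m hom)
      , k≢0 ∘ to (x≡y-k*N⇒[x≡y⇔k≡0] N≥1 pq≡) ∘ to (ratGeomProg⇔p*last≡a*mᵈ {c = c} a p m hom a≢0 p≢0))
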